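{- Let $n>2$, $n_1=n(n+1)/2$, let $[G]$ be a binding graph of order $n_1$ and $\mathrm{wl}([G])=(m_{ij})$. For basic vertices $u,v,r,s\in[n]$ with $u\ne v$, $r\ne s$, and $p=u\wedge v$, $q=r\wedge s$, the following are equivalent (equalities of multisets): (a) $\{\!\{m_{uv},m_{vu}\}\!\}=\{\!\{m_{rs},m_{sr}\}\!\}$; (b) $\{\!\{m_{up},m_{vp}\}\!\}=\{\!\{m_{rq},m_{sq}\}\!\}$; (c) $m_{pp}=m_{qq}$.
   Context: Labeled graphs: $\mathrm{Var}$ is an infinite set of independent variables and $x_0\notin\mathrm{Var}$ a reserved symbol. A labeled graph of order $N$ is an $N\times N$ matrix $G=(g_{ij})$ with entries in $\{x_0\}\cup\mathrm{Var}$; vertex set $[N]$, $g_{ii}$ is the label of vertex $i$; for $i\neq j$, $(i,j)$ is an edge iff $g_{ij}\ne x_0$. $\dim(G)$ is the number of distinct symbols in $G$. A simple graph has $G^\top=G$, $\dim(G)\le2$, $g_{ii}=x_0$. Diamond product: $(G\diamond G)_{ij}=\{\!\{(g_{ik},g_{kj}):k\in[N]\}\!\}$. $\mathrm{evs}(A)$ replaces entries of $A$ by variables of $\mathrm{Var}$ so that equal entries get equal variables and distinct entries distinct ones. WL algorithm: $G_1$ from $G$ by replacing diagonal entries by fresh variables (equal iff equal before, none occurring off-diagonal), $G_{t+1}=\mathrm{evs}(G_t\diamond G_t)$ until $\dim(G_t)=\dim(G_{t+1})$, $\mathrm{wl}(G):=G_t$ (a representative is fixed). Binding graphs: a binding graph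 of order $n_1=n(n+1)/2$ is a simple graph such that for every pair of distinct $u,v\in[n]$ there is a unique vertex $u\wedge v\in[n+1,n_1]$ whose neighbours are exactly $u$ and $v$, distinct pairs giving distinct vertices; its subgraph induced on $[n]$ is the basic graph $G$ and it is denoted $[G]$. Vertices in $[n]$ are basic. -}

module Defs where

open import Data.Nat using (ℕ; _<_; _≤_; _*_; suc)
open import Data.Nat.DivMod using (_/_)
import Data.Nat.Properties as ℕP
open import Data.Fin using (Fin; toℕ)
open import Data.List using (List; map; concatMap; length; deduplicate; _∷_; [])
open import Data.List.Relation.Binary.Permutation.Propositional using (_↭_)
open import Data.Product using (_×_; _,_; Σ; ∃; ∃-syntax)
open import Data.Sum using (_⊎_)
open import Data.Fin using () renaming (_≟_ to _≟F_)
open import Data.List using (allFin)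
open import Function.Bundles using (_⇔_)
open import Relation.Binary.PropositionalEquality using (_≡_; _≢_; refl; cong)
open import Relation.Nullary using (Dec; yes; no; ¬_)

data Sym : Set where
  x₀  : Sym
  var : ℕ → Sym

_≟ₛ_ : (a b : Sym) → Dec (a ≡ b)
x₀    ≟ₛ x₀    = yes refl
x₀    ≟ₛ var _ = no λ ()
var _ ≟ₛ x₀    = no λ ()
var m ≟ₛ var n with m ℕP.≟ n
... | yes refl = yes refl
... | no m≢n  = no λ { refl → m≢n refl }

LGraph : ℕ → Set
LGraph N = Fin N → Fin N → Sym

entries : ∀ {N} → LGraph N → List Sym
entries {N} G = concatMap (λ i → map (λ j → G i j) (allFin N)) (allFin N)

dim : ∀ {N} → LGraph N → ℕ
dim G = length (deduplicate _≟ₛ_ (entries G))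

Adj : ∀ {N} → LGraph N → Fin N → Fin N → Set
Adj G i j = (i ≢ j) × (G i j ≢ x₀)

-- Diamond product entry (G ◇ G)_ij as a list; multisets compared up to _↭_.
diamond : ∀ {N} → LGraph N → Fin N → Fin N → List (Sym × Sym)
diamond {N} G i j = map (λ k → (G i k , G k j)) (allFin N)

MSet2Eq : Sym → Sym → Sym → Sym → Set
MSet2Eq a b c d = (a ∷ b ∷ []) ↭ (c ∷ d ∷ [])

-- G₁ is obtained from G by replacing the diagonal entries by fresh variables,
-- equal iff equal before, none occurring off-diagonal.
record Init {N} (G G₁ : LGraph N) : Set where
  field
    offdiag : ∀ i j → i ≢ j → G₁ i j ≡ G i j
    diagVar : ∀ i → G₁ i i ≢ x₀
    diagEq  : ∀ i k → (G₁ i i ≡ G₁ k k) ⇔ (G i i ≡ G k k)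
    fresh   : ∀ i k l → k ≢ l → G₁ i i ≢ G₁ k l

-- B = evs(A ◇ A) (for some choice of variables).
record Refines {N} (A B : LGraph N) : Set where
  field
    isVar : ∀ i j → B i j ≢ x₀
    evs   : ∀ i j k l → (B i j ≡ B k l) ⇔ (diamond A i j ↭ diamond A k l)

-- WLRun A M: iterating G_{t+1} = evs(G_t ◇ G_t) from A stops at M, i.e. M is
-- the first G_t with dim(G_t) = dim(G_{t+1}).
data WLRun {N} : LGraph N → LGraph N → Set where
  stop : ∀ {A B} → Refines A B → dim A ≡ dim B → WLRun A A
  step : ∀ {A B C} → Refines A B → ¬ (dim A ≡ dim B) → WLRun B C → WLRun A C

-- M is (a representative of) wl(G)
IsWL : ∀ {N} → LGraph N → LGraph N → Set
IsWL G M = ∃[ G₁ ] (Init G G₁ × WLRun G₁ M)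

record Simple {N} (G : LGraph N) : Set where
  field
    symm  : ∀ i j → G i j ≡ G j i
    dim≤2 : dim G ≤ 2
    diag  : ∀ i → G i i ≡ x₀

order : ℕ → ℕ
order n = (n * suc n) / 2

Basic : ∀ n → Fin (order n) → Set
Basic n i = toℕ i < n

IsWedge : ∀ n → LGraph (order n) → Fin (order n) → Fin (order n) → Fin (order n) → Set
IsWedge n G u v p = (n ≤ toℕ p) × (∀ w → Adj G p w ⇔ ((w ≡ u) ⊎ (w ≡ v)))

record Binding (n : ℕ) (G : LGraph (order n)) : Set where
  field
    simple : Simple G
    wedge-exists : ∀ u v → Basic n u → Basic n v → u ≢ v → ∃[ p ] IsWedge n G u v p
    wedge-unique : ∀ u v p p′ → Basic n u → Basic n v → u ≢ v →
                   IsWedge n G u v p → IsWedge n G u v p′ → p ≡ p′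
    wedge-injective : ∀ u v r s p → Basic n u → Basic n v → u ≢ v →
                      Basic n r → Basic n s → r ≢ s →
                      IsWedge n G u v p → IsWedge n G r s p →
                      ((u ≡ r) × (v ≡ s)) ⊎ ((u ≡ s) × (v ≡ r))

-- Colour refinement ends in a colouring M that is diagonally separated, finer than G and stable
-- (equal colours have equal diamond multisets); stability holds at the fixpoint because a strict
-- refinement would increase the number of colours. In a stable colouring adjacency depends only
-- on the colour, so equally coloured vertices have equal degree, and a vertex coloured like a
-- wedge u ∧ v has at most two neighbours; adjacent to distinct basic r and s, it must be r ∧ s.
-- Matching the diamond multisets of the entries in question at the index p, v or a neighbour of
-- p then transports each colour condition into the next.
{-# OPTIONS --safe #-}
module Submission where

open import Defs
open import Data.Nat using (ℕ; suc; _+_; _<_; _≤_; s≤s; z≤n)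
open import Data.Nat.Properties
  using (≤-refl; ≤-trans; ≤-reflexive; <-irrefl; <-≤-trans; ≮⇒≥; _<?_; +-suc; module ≤-Reasoning)
open import Data.Fin using (Fin; toℕ) renaming (_≟_ to _≟F_)
open import Data.Fin.Properties using (any?)
open import Data.List using (List; []; _∷_; _++_; map; filter; length; allFin; concatMap; deduplicate)
open import Data.List.Properties using (length-map; length-++; filter-≐)
open import Data.List.Membership.Propositional using (_∈_)
open import Data.List.Membership.Propositional.Properties
  using (∈-map⁺; ∈-map⁻; ∈-allFin; ∈-∃++; ∈-++⁻; ∈-++⁺ˡ; ∈-++⁺ʳ; ∈-filter⁺; ∈-filter⁻;
         ∈-concatMap⁺; ∈-concatMap⁻; ∈-deduplicate⁺; ∈-deduplicate⁻)
open import Data.List.Relation.Unary.Any using (here; there; satisfied)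
import Data.List.Relation.Unary.Any as Any
open import Data.List.Relation.Unary.All using (lookup; []; _∷_)
open import Data.List.Relation.Unary.AllPairs using ([]; _∷_)
open import Data.List.Relation.Unary.Unique.Propositional using (Unique)
open import Data.List.Relation.Unary.Unique.Propositional.Properties using (allFin⁺; filter⁺)
open import Data.List.Relation.Unary.Unique.DecPropositional.Properties _≟ₛ_ using (deduplicate-!)
open import Data.List.Relation.Binary.Permutation.Propositional
  using (_↭_; ↭-refl; ↭-trans; ↭-swap)
open import Data.List.Relation.Binary.Permutation.Propositional.Properties
  using (∈-resp-↭; drop-∷; ↭-singleton-inv; ↭-length; filter-↭)
open import Data.List.Relation.Binary.Subset.Propositional using (_⊆_)
open import Data.Product using (_×_; _,_; ∃-syntax; proj₁; proj₂)
open import Data.Sum using (_⊎_; inj₁; inj₂; swap)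
open import Data.Empty using (⊥; ⊥-elim)
open import Data.Bool using (true; false)
open import Function using (_∘_)
open import Function.Bundles using (_⇔_; Equivalence; mk⇔)
open import Relation.Nullary using (yes; no; does; ¬?)
open import Relation.Nullary.Decidable using (_×-dec_)
open import Relation.Unary using (Pred; Decidable; _≐_)
open import Relation.Binary.PropositionalEquality

module _ {a b c d : Sym} where

  MSet2Eq-split : MSet2Eq a b c d → (a ≡ c × b ≡ d) ⊎ (a ≡ d × b ≡ c)
  MSet2Eq-split p with ∈-resp-↭ p (here refl)
  ... | here refl with ↭-singleton-inv (drop-∷ p)
  ...   | refl = inj₁ (refl , refl)
  MSet2Eq-split p | there (here refl) with ↭-singleton-inv (drop-∷ (↭-trans p (↭-swap c a ↭-refl)))
  ...   | refl = inj₂ (refl , refl)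

  MSet2Eq-straight : a ≡ c → b ≡ d → MSet2Eq a b c d
  MSet2Eq-straight refl refl = ↭-refl

  MSet2Eq-crossed : a ≡ d → b ≡ c → MSet2Eq a b c d
  MSet2Eq-crossed refl refl = ↭-swap a b ↭-refl

  MSet2Eq-from-mutual-∈ : a ≡ c ⊎ a ≡ d → b ≡ c ⊎ b ≡ d → c ≡ a ⊎ c ≡ b → d ≡ a ⊎ d ≡ b →
                          MSet2Eq a b c d
  MSet2Eq-from-mutual-∈ (inj₁ a≡c) (inj₂ b≡d) _          _          = MSet2Eq-straight a≡c b≡d
  MSet2Eq-from-mutual-∈ (inj₂ a≡d) (inj₁ b≡c) _          _          = MSet2Eq-crossed a≡d b≡c
  MSet2Eq-from-mutual-∈ (inj₁ a≡c) (inj₁ b≡c) _          (inj₁ d≡a) = MSet2Eq-crossed (sym d≡a) b≡c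
  MSet2Eq-from-mutual-∈ (inj₁ a≡c) (inj₁ b≡c) _          (inj₂ d≡b) =
    MSet2Eq-crossed (trans a≡c (trans (sym b≡c) (sym d≡b))) b≡c
  MSet2Eq-from-mutual-∈ (inj₂ a≡d) (inj₂ b≡d) (inj₁ c≡a) _          = MSet2Eq-straight (sym c≡a) b≡d
  MSet2Eq-from-mutual-∈ (inj₂ a≡d) (inj₂ b≡d) (inj₂ c≡b) _          =
    MSet2Eq-straight (trans a≡d (trans (sym b≡d) (sym c≡b))) b≡d

∈-++-∷-drop : ∀ {a} {A : Set a} {x y : A} as bs → y ∈ as ++ x ∷ bs → y ≢ x → y ∈ as ++ bs
∈-++-∷-drop as bs y∈ y≢x with ∈-++⁻ as y∈
... | inj₁ y∈as         = ∈-++⁺ˡ y∈as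
... | inj₂ (here y≡x)   = ⊥-elim (y≢x y≡x)
... | inj₂ (there y∈bs) = ∈-++⁺ʳ as y∈bs

length-++-∷ : ∀ {a} {A : Set a} (x : A) as bs → length (as ++ x ∷ bs) ≡ suc (length (as ++ bs))
length-++-∷ x as bs = begin
  length (as ++ x ∷ bs)          ≡⟨ length-++ as ⟩
  length as + suc (length bs)    ≡⟨ +-suc (length as) (length bs) ⟩
  suc (length as + length bs)    ≡⟨ cong suc (length-++ as) ⟨
  suc (length (as ++ bs))        ∎
  where open ≡-Reasoning

module _ {a} {A : Set a} where

  Unique-⊆⇒length≤ : ∀ {xs ys : List A} → Unique xs → xs ⊆ ys → length xs ≤ length ys
  Unique-⊆⇒length≤ {[]}     _              _   = z≤n
  Unique-⊆⇒length≤ {x ∷ xs} (x∉xs ∷ uniq) sub with ∈-∃++ (sub (here refl))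
  ... | as , bs , refl =
    ≤-trans (s≤s (Unique-⊆⇒length≤ uniq sub′)) (≤-reflexive (sym (length-++-∷ x as bs)))
    where
    sub′ : xs ⊆ as ++ bs
    sub′ y∈xs = ∈-++-∷-drop as bs (sub (there y∈xs)) λ { refl → lookup x∉xs y∈xs refl }

  Unique-⊆-map⇒length< : ∀ {b} {B : Set b} {f : B → A} {xs ys y₁ y₂} →
                         Unique xs → xs ⊆ map f ys → y₁ ∈ ys → y₂ ∈ ys → y₁ ≢ y₂ → f y₁ ≡ f y₂ →
                         length xs < length ys
  Unique-⊆-map⇒length< {f = f} {xs} {y₁ = y₁} {y₂} uniq sub y₁∈ y₂∈ y₁≢y₂ fy₁≡fy₂ with ∈-∃++ y₂∈
  ... | as , bs , refl = begin-strict
    length xs                 ≤⟨ Unique-⊆⇒length≤ uniq sub′ ⟩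
    length (map f (as ++ bs)) ≡⟨ length-map f (as ++ bs) ⟩
    length (as ++ bs)         <⟨ s≤s ≤-refl ⟩
    suc (length (as ++ bs))   ≡⟨ length-++-∷ y₂ as bs ⟨
    length (as ++ y₂ ∷ bs)    ∎
    where
    open ≤-Reasoning
    y₁∈′ : y₁ ∈ as ++ bs
    y₁∈′ = ∈-++-∷-drop as bs y₁∈ y₁≢y₂
    sub′ : xs ⊆ map f (as ++ bs)
    sub′ x∈xs with ∈-map⁻ f (sub x∈xs)
    ... | y , y∈ , refl with ∈-++⁻ as y∈
    ...   | inj₁ y∈as         = ∈-map⁺ f (∈-++⁺ˡ y∈as)
    ...   | inj₂ (here refl)  = subst (_∈ map f (as ++ bs)) fy₁≡fy₂ (∈-map⁺ f y₁∈′)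
    ...   | inj₂ (there y∈bs) = ∈-map⁺ f (∈-++⁺ʳ as y∈bs)

filter-map : ∀ {a b p} {A : Set a} {B : Set b} {P : Pred B p} (P? : Decidable P) (f : A → B) xs →
             filter P? (map f xs) ≡ map f (filter (P? ∘ f) xs)
filter-map P? f []       = refl
filter-map P? f (x ∷ xs) with does (P? (f x))
... | true  = cong (f x ∷_) (filter-map P? f xs)
... | false = filter-map P? f xs

module _ {N : ℕ} where

  DiagonalSeparated : LGraph N → Set
  DiagonalSeparated A = ∀ i k l → k ≢ l → A i i ≢ A k l

  Finer : LGraph N → LGraph N → Set
  Finer A B = ∀ i j k l → A i j ≡ A k l → B i j ≡ B k l

  Stable : LGraph N → Set
  Stable A = ∀ i j k l → A i j ≡ A k l → diamond A i j ↭ diamond A k l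

  Finer-trans : ∀ {A B C} → Finer A B → Finer B C → Finer A C
  Finer-trans A≤B B≤C i j k l = B≤C i j k l ∘ A≤B i j k l

  Init⇒Finer : ∀ {G G₁} → Init G G₁ → Finer G₁ G
  Init⇒Finer I i j k l e with i ≟F j | k ≟F l
  ... | yes refl | yes refl = Equivalence.to (Init.diagEq I i k) e
  ... | yes refl | no k≢l   = ⊥-elim (Init.fresh I i k l k≢l e)
  ... | no i≢j   | yes refl = ⊥-elim (Init.fresh I k i j i≢j (sym e))
  ... | no i≢j   | no k≢l   = trans (sym (Init.offdiag I i j i≢j)) (trans e (Init.offdiag I k l k≢l))

  diamond-↭⇒match : (A : LGraph N) {i j k l : Fin N} → diamond A i j ↭ diamond A k l →
                    ∀ t → ∃[ t′ ] (A i t ≡ A k t′ × A t j ≡ A t′ l)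
  diamond-↭⇒match A {i} {j} {k} {l} i∙j↭k∙l t
    with ∈-map⁻ (λ t′ → A k t′ , A t′ l) (∈-resp-↭ i∙j↭k∙l (∈-map⁺ (λ t → A i t , A t j) (∈-allFin t)))
  ... | t′ , _ , same = t′ , cong proj₁ same , cong proj₂ same

  module _ {A : LGraph N} (separated : DiagonalSeparated A) {i j k l : Fin N}
           (i∙j↭k∙l : diamond A i j ↭ diamond A k l) where

    diamond-↭⇒≡ : A i j ≡ A k l
    diamond-↭⇒≡ with diamond-↭⇒match A i∙j↭k∙l i
    ... | t′ , Aii≡Akt′ , Aij≡At′l with k ≟F t′
    ...   | yes refl = Aij≡At′l
    ...   | no k≢t′  = ⊥-elim (separated i k t′ k≢t′ Aii≡Akt′)

    diamond-↭⇒diag≡ : A j j ≡ A l l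
    diamond-↭⇒diag≡ with diamond-↭⇒match A i∙j↭k∙l j
    ... | t′ , _ , Ajj≡At′l with t′ ≟F l
    ...   | yes refl = Ajj≡At′l
    ...   | no t′≢l  = ⊥-elim (separated j t′ l t′≢l Ajj≡At′l)

  module _ {A B : LGraph N} (separated : DiagonalSeparated A) (R : Refines A B) where

    Refines⇒Finer : Finer B A
    Refines⇒Finer i j k l = diamond-↭⇒≡ separated ∘ Equivalence.to (Refines.evs R i j k l)

    Refines⇒DiagonalSeparated : DiagonalSeparated B
    Refines⇒DiagonalSeparated i k l k≢l = separated i k l k≢l ∘ Refines⇒Finer i i k l

  ∈-entries : (A : LGraph N) → ∀ i j → A i j ∈ entries A
  ∈-entries A i j = ∈-concatMap⁺ (λ i → map (A i) (allFin N))
    (Any.map (λ { refl → ∈-map⁺ (A i) (∈-allFin j) }) (∈-allFin i))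

  ∈-entries⁻ : (A : LGraph N) {c : Sym} → c ∈ entries A → ∃[ i ] ∃[ j ] (c ≡ A i j)
  ∈-entries⁻ A c∈ with satisfied (∈-concatMap⁻ (λ i → map (A i) (allFin N)) {xs = allFin N} c∈)
  ... | i , c∈row with ∈-map⁻ (A i) c∈row
  ...   | j , _ , c≡Aij = i , j , c≡Aij

  colours : LGraph N → List Sym
  colours A = deduplicate _≟ₛ_ (entries A)

  module _ {A B : LGraph N} (B≤A : Finer B A) where

    translate : Sym → Sym
    translate c with any? (λ i → any? (λ j → B i j ≟ₛ c))
    ... | yes (i , j , _) = A i j
    ... | no _            = x₀

    translate-correct : ∀ i j → translate (B i j) ≡ A i j
    translate-correct i j with any? (λ i′ → any? (λ j′ → B i′ j′ ≟ₛ B i j))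
    ... | yes (i′ , j′ , Bi′j′≡Bij) = B≤A i′ j′ i j Bi′j′≡Bij
    ... | no ∄                      = ⊥-elim (∄ (i , j , refl))

    colours⊆translated : colours A ⊆ map translate (colours B)
    colours⊆translated c∈ with ∈-entries⁻ A (∈-deduplicate⁻ _≟ₛ_ (entries A) c∈)
    ... | i , j , refl = subst (_∈ map translate (colours B)) (translate-correct i j)
                           (∈-map⁺ translate (∈-deduplicate⁺ _≟ₛ_ (∈-entries B i j)))

    equal-dim⇒Finer : dim A ≡ dim B → Finer A B
    equal-dim⇒Finer dimA≡dimB i j k l Aij≡Akl with B i j ≟ₛ B k l
    ... | yes Bij≡Bkl = Bij≡Bkl
    ... | no Bij≢Bkl  = ⊥-elim (<-irrefl dimA≡dimB
      (Unique-⊆-map⇒length< (deduplicate-! (entries A)) colours⊆translated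
        (∈-colours B i j) (∈-colours B k l) Bij≢Bkl
        (trans (translate-correct i j) (trans Aij≡Akl (sym (translate-correct k l))))))
      where
      ∈-colours : (C : LGraph N) → ∀ i j → C i j ∈ colours C
      ∈-colours C i j = ∈-deduplicate⁺ _≟ₛ_ (∈-entries C i j)

  record StableRefinement (G M : LGraph N) : Set where
    field
      separated : DiagonalSeparated M
      finer     : Finer M G
      stable    : Stable M

  WLRun⇒StableRefinement : ∀ {G A M} → DiagonalSeparated A → Finer A G → WLRun A M →
                           StableRefinement G M
  WLRun⇒StableRefinement separated A≤G (stop R dim≡) = record
    { separated = separated
    ; finer     = A≤G
    ; stable    = λ i j k l → Equivalence.to (Refines.evs R i j k l)
                            ∘ equal-dim⇒Finer (Refines⇒Finer separated R) dim≡ i j k l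
    }
  WLRun⇒StableRefinement separated A≤G (step R _ run) =
    WLRun⇒StableRefinement (Refines⇒DiagonalSeparated separated R)
                           (Finer-trans (Refines⇒Finer separated R) A≤G) run

  IsWL⇒StableRefinement : ∀ {G M} → IsWL G M → StableRefinement G M
  IsWL⇒StableRefinement (G₁ , I , run) = WLRun⇒StableRefinement (Init.fresh I) (Init⇒Finer I) run

module Wedge (n : ℕ) (G : LGraph (order n)) where

  IsWedge-adjˡ : ∀ {u v p} → IsWedge n G u v p → Adj G p u
  IsWedge-adjˡ (_ , nbrs) = Equivalence.from (nbrs _) (inj₁ refl)

  IsWedge-adjʳ : ∀ {u v p} → IsWedge n G u v p → Adj G p v
  IsWedge-adjʳ (_ , nbrs) = Equivalence.from (nbrs _) (inj₂ refl)

  IsWedge-neighbour : ∀ {u v p w} → IsWedge n G u v p → Adj G p w → w ≡ u ⊎ w ≡ v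
  IsWedge-neighbour (_ , nbrs) = Equivalence.to (nbrs _)

  IsWedge-swap : ∀ {u v p} → IsWedge n G u v p → IsWedge n G v u p
  IsWedge-swap (n≤p , nbrs) = n≤p , λ w →
    mk⇔ (swap ∘ Equivalence.to (nbrs w)) (Equivalence.from (nbrs w) ∘ swap)

  Basic⇒≢wedge : ∀ {r u v p} → Basic n r → IsWedge n G u v p → r ≢ p
  Basic⇒≢wedge r<n (n≤p , _) refl = <-irrefl refl (<-≤-trans r<n n≤p)

module BindingGraph {n : ℕ} {G : LGraph (order n)} (binding : Binding n G)
                    {M : LGraph (order n)} (wl : StableRefinement G M) where

  open Binding binding
  open StableRefinement wl
  open Wedge n G

  private
    N : ℕ
    N = order n

  Adj-sym : ∀ {i j} → Adj G i j → Adj G j i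
  Adj-sym {i} {j} (i≢j , Gij≢x₀) = i≢j ∘ sym , Gij≢x₀ ∘ trans (Simple.symm simple i j)

  Adj-resp-colour : ∀ {i j k l} → Adj G i j → M i j ≡ M k l → Adj G k l
  Adj-resp-colour {i} {j} {k} {l} (i≢j , Gij≢x₀) Mij≡Mkl = k≢l , Gij≢x₀ ∘ trans (finer i j k l Mij≡Mkl)
    where
    k≢l : k ≢ l
    k≢l refl = separated k i j i≢j (sym Mij≡Mkl)

  adj? : ∀ k → Decidable (Adj G k)
  adj? k t = ¬? (k ≟F t) ×-dec ¬? (G k t ≟ₛ x₀)

  degree : Fin N → ℕ
  degree k = length (filter (adj? k) (allFin N))

  EdgeColour : Sym → Set
  EdgeColour c = ∃[ i ] ∃[ j ] (Adj G i j × M i j ≡ c)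

  edgeColour? : Decidable EdgeColour
  edgeColour? c = any? (λ i → any? (λ j → adj? i j ×-dec (M i j ≟ₛ c)))

  degree≡count-edge-colours : ∀ k → degree k ≡ length (filter (edgeColour? ∘ proj₁) (diamond M k k))
  degree≡count-edge-colours k = begin
    length (filter (adj? k) (allFin N))
      ≡⟨ cong length (filter-≐ (adj? k) (edgeColour? ∘ M k) adj⇔edge (allFin N)) ⟩
    length (filter (edgeColour? ∘ M k) (allFin N))
      ≡⟨ length-map (λ t → M k t , M t k) (filter (edgeColour? ∘ M k) (allFin N)) ⟨
    length (map (λ t → M k t , M t k) (filter (edgeColour? ∘ M k) (allFin N)))
      ≡⟨ cong length (filter-map (edgeColour? ∘ proj₁) (λ t → M k t , M t k) (allFin N)) ⟨
    length (filter (edgeColour? ∘ proj₁) (diamond M k k)) ∎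
    where
    open ≡-Reasoning
    adj⇔edge : Adj G k ≐ (EdgeColour ∘ M k)
    adj⇔edge = (λ {t} kt → k , t , kt , refl) , λ { (i , j , ij , Mij≡Mkt) → Adj-resp-colour ij Mij≡Mkt }

  degree-resp-colour : ∀ {k p} → M k k ≡ M p p → degree k ≡ degree p
  degree-resp-colour {k} {p} Mkk≡Mpp = begin
    degree k                                              ≡⟨ degree≡count-edge-colours k ⟩
    length (filter (edgeColour? ∘ proj₁) (diamond M k k)) ≡⟨ ↭-length (filter-↭ _ (stable k k p p Mkk≡Mpp)) ⟩
    length (filter (edgeColour? ∘ proj₁) (diamond M p p)) ≡⟨ degree≡count-edge-colours p ⟨
    degree p                                              ∎
    where open ≡-Reasoning

  neighbours⊆⇒degree≤ : ∀ {k} {ws : List (Fin N)} → (∀ {t} → Adj G k t → t ∈ ws) →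
                        degree k ≤ length ws
  neighbours⊆⇒degree≤ {k} nbrs⊆ = Unique-⊆⇒length≤ (filter⁺ (adj? k) (allFin⁺ N))
    (nbrs⊆ ∘ proj₂ ∘ ∈-filter⁻ (adj? k) {xs = allFin N})

  neighbours⊇⇒degree≥ : ∀ {k} {ws : List (Fin N)} → Unique ws → (∀ {t} → t ∈ ws → Adj G k t) →
                        length ws ≤ degree k
  neighbours⊇⇒degree≥ {k} uniq ws⊆nbrs =
    Unique-⊆⇒length≤ uniq λ t∈ → ∈-filter⁺ (adj? k) (∈-allFin _) (ws⊆nbrs t∈)

  IsWedge⇒degree≤2 : ∀ {u v p} → IsWedge n G u v p → degree p ≤ 2
  IsWedge⇒degree≤2 {u} {v} wedge =
    neighbours⊆⇒degree≤ {ws = u ∷ v ∷ []} (here-or-there ∘ IsWedge-neighbour wedge)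
    where
    here-or-there : ∀ {t} → t ≡ u ⊎ t ≡ v → t ∈ u ∷ v ∷ []
    here-or-there (inj₁ t≡u) = here t≡u
    here-or-there (inj₂ t≡v) = there (here t≡v)

  three-neighbours⇒3≤degree : ∀ {k a b c} → Adj G k a → Adj G k b → Adj G k c →
                              a ≢ b → a ≢ c → b ≢ c → 3 ≤ degree k
  three-neighbours⇒3≤degree ka kb kc a≢b a≢c b≢c = neighbours⊇⇒degree≥
    ((a≢b ∷ a≢c ∷ []) ∷ (b≢c ∷ []) ∷ [] ∷ [])
    λ { (here refl) → ka ; (there (here refl)) → kb ; (there (there (here refl))) → kc }

  wedge-coloured⇒¬three-neighbours : ∀ {u v p k a b c} → IsWedge n G u v p → M k k ≡ M p p →
                                     Adj G k a → Adj G k b → Adj G k c → a ≢ b → a ≢ c → b ≢ c → ⊥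
  wedge-coloured⇒¬three-neighbours wedge Mkk≡Mpp ka kb kc a≢b a≢c b≢c = <-irrefl refl (begin-strict
    2        <⟨ three-neighbours⇒3≤degree ka kb kc a≢b a≢c b≢c ⟩
    degree _ ≡⟨ degree-resp-colour Mkk≡Mpp ⟩
    degree _ ≤⟨ IsWedge⇒degree≤2 wedge ⟩
    2        ∎)
    where open ≤-Reasoning

  -- A basic k adjacent to r would have the third neighbour k ∧ r; a non-basic k adjacent only
  -- to r and s is a wedge of r and s.
  wedge-coloured⇒wedge : ∀ {u v p r s q k} → IsWedge n G u v p → M k k ≡ M p p →
                         Basic n r → Basic n s → r ≢ s → IsWedge n G r s q →
                         Adj G k r → Adj G k s → k ≡ q
  wedge-coloured⇒wedge {r = r} {s} {k = k} wedge Mkk≡Mpp r<n s<n r≢s wedge′ kr ks with toℕ k <? n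
  ... | yes k<n with wedge-exists k r k<n r<n (proj₁ kr)
  ...   | _ , k∧r = ⊥-elim (wedge-coloured⇒¬three-neighbours wedge Mkk≡Mpp
                      kr ks (Adj-sym (IsWedge-adjˡ k∧r)) r≢s (Basic⇒≢wedge r<n k∧r) (Basic⇒≢wedge s<n k∧r))
  wedge-coloured⇒wedge {r = r} {s} {k = k} wedge Mkk≡Mpp r<n s<n r≢s wedge′ kr ks | no k≮n =
    wedge-unique r s k _ r<n s<n r≢s (≮⇒≥ k≮n , λ w → mk⇔ (only-r-s w) r-or-s) wedge′
    where
    r-or-s : ∀ {w} → w ≡ r ⊎ w ≡ s → Adj G k w
    r-or-s (inj₁ refl) = kr
    r-or-s (inj₂ refl) = ks

    only-r-s : ∀ w → Adj G k w → w ≡ r ⊎ w ≡ s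
    only-r-s w kw with w ≟F r | w ≟F s
    ... | yes w≡r | _       = inj₁ w≡r
    ... | no _    | yes w≡s = inj₂ w≡s
    ... | no w≢r  | no w≢s  =
      ⊥-elim (wedge-coloured⇒¬three-neighbours wedge Mkk≡Mpp kr ks kw r≢s (w≢r ∘ sym) (w≢s ∘ sym))

  edge-colour⇒wedge-colour : ∀ {u v p r s q} → IsWedge n G u v p →
                             Basic n r → Basic n s → r ≢ s → IsWedge n G r s q →
                             M u v ≡ M r s → M u p ≡ M r q
  edge-colour⇒wedge-colour {u} {v} {p} {r} {s} {q} wedge r<n s<n r≢s wedge′ Muv≡Mrs
    with diamond-↭⇒match M (stable u v r s Muv≡Mrs) p
  ... | t , Mup≡Mrt , Mpv≡Mts = subst (λ x → M u p ≡ M r x) t≡q Mup≡Mrt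
    where
    t≡q : t ≡ q
    t≡q = wedge-coloured⇒wedge wedge
            (sym (diamond-↭⇒diag≡ separated (stable u p r t Mup≡Mrt))) r<n s<n r≢s wedge′
            (Adj-sym (Adj-resp-colour (Adj-sym (IsWedge-adjˡ wedge)) Mup≡Mrt))
            (Adj-resp-colour (IsWedge-adjʳ wedge) Mpv≡Mts)

  wedge-colour⇒edge-colour : ∀ {u v p r s q} → IsWedge n G u v p → IsWedge n G r s q → u ≢ v →
                             M u p ≡ M r q → M u v ≡ M r s
  wedge-colour⇒edge-colour {u} {v} {p} {r} {s} {q} wedge wedge′ u≢v Mup≡Mrq
    with diamond-↭⇒match M (stable u p r q Mup≡Mrq) v
  ... | t , Muv≡Mrt , Mvp≡Mtq
    with IsWedge-neighbour wedge′ (Adj-sym (Adj-resp-colour (Adj-sym (IsWedge-adjʳ wedge)) Mvp≡Mtq))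
  ...   | inj₁ refl = ⊥-elim (separated r u v u≢v (sym Muv≡Mrt))
  ...   | inj₂ refl = Muv≡Mrt

  wedge-colour⇒neighbour-colour : ∀ {u v p r s q x} → IsWedge n G u v p → IsWedge n G r s q →
                                  M p p ≡ M q q → Adj G p x → M x p ≡ M r q ⊎ M x p ≡ M s q
  wedge-colour⇒neighbour-colour {p = p} {q = q} {x} wedge wedge′ Mpp≡Mqq px
    with diamond-↭⇒match M (stable p p q q Mpp≡Mqq) x
  ... | t , Mpx≡Mqt , Mxp≡Mtq with IsWedge-neighbour wedge′ (Adj-resp-colour px Mpx≡Mqt)
  ...   | inj₁ refl = inj₁ Mxp≡Mtq
  ...   | inj₂ refl = inj₂ Mxp≡Mtq

  module _ {u v p r s q} (wedge : IsWedge n G u v p) (wedge′ : IsWedge n G r s q) where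

    private
      wedgeᵗ  = IsWedge-swap wedge
      wedge′ᵗ = IsWedge-swap wedge′

    edge-pair⇒wedge-pair : Basic n r → Basic n s → r ≢ s →
                           MSet2Eq (M u v) (M v u) (M r s) (M s r) → MSet2Eq (M u p) (M v p) (M r q) (M s q)
    edge-pair⇒wedge-pair r<n s<n r≢s m with MSet2Eq-split m
    ... | inj₁ (e , e′) = MSet2Eq-straight (edge-colour⇒wedge-colour wedge r<n s<n r≢s wedge′ e)
                                           (edge-colour⇒wedge-colour wedgeᵗ s<n r<n (r≢s ∘ sym) wedge′ᵗ e′)
    ... | inj₂ (e , e′) = MSet2Eq-crossed (edge-colour⇒wedge-colour wedge s<n r<n (r≢s ∘ sym) wedge′ᵗ e)
                                          (edge-colour⇒wedge-colour wedgeᵗ r<n s<n r≢s wedge′ e′)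

    wedge-pair⇒edge-pair : u ≢ v →
                           MSet2Eq (M u p) (M v p) (M r q) (M s q) → MSet2Eq (M u v) (M v u) (M r s) (M s r)
    wedge-pair⇒edge-pair u≢v m with MSet2Eq-split m
    ... | inj₁ (e , e′) = MSet2Eq-straight (wedge-colour⇒edge-colour wedge wedge′ u≢v e)
                                           (wedge-colour⇒edge-colour wedgeᵗ wedge′ᵗ (u≢v ∘ sym) e′)
    ... | inj₂ (e , e′) = MSet2Eq-crossed (wedge-colour⇒edge-colour wedge wedge′ᵗ u≢v e)
                                          (wedge-colour⇒edge-colour wedgeᵗ wedge′ (u≢v ∘ sym) e′)

    wedge-colour⇒wedge-pair : M p p ≡ M q q → MSet2Eq (M u p) (M v p) (M r q) (M s q)
    wedge-colour⇒wedge-pair e = MSet2Eq-from-mutual-∈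
      (wedge-colour⇒neighbour-colour wedge wedge′ e (IsWedge-adjˡ wedge))
      (wedge-colour⇒neighbour-colour wedge wedge′ e (IsWedge-adjʳ wedge))
      (wedge-colour⇒neighbour-colour wedge′ wedge (sym e) (IsWedge-adjˡ wedge′))
      (wedge-colour⇒neighbour-colour wedge′ wedge (sym e) (IsWedge-adjʳ wedge′))

  wedge-pair⇒wedge-colour : ∀ {u v p r s q} → MSet2Eq (M u p) (M v p) (M r q) (M s q) → M p p ≡ M q q
  wedge-pair⇒wedge-colour {u} {v} {p} {r} {s} {q} m with MSet2Eq-split m
  ... | inj₁ (e , _) = diamond-↭⇒diag≡ separated (stable u p r q e)
  ... | inj₂ (e , _) = diamond-↭⇒diag≡ separated (stable u p s q e)

lemma6p2 : (n : ℕ) → 2 < n → (G : LGraph (order n)) → Binding n G →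
           (M : LGraph (order n)) → IsWL G M →
           (u v r s p q : Fin (order n)) →
           Basic n u → Basic n v → Basic n r → Basic n s → u ≢ v → r ≢ s →
           IsWedge n G u v p → IsWedge n G r s q →
           (MSet2Eq (M u v) (M v u) (M r s) (M s r) ⇔ MSet2Eq (M u p) (M v p) (M r q) (M s q))
           × (MSet2Eq (M u p) (M v p) (M r q) (M s q) ⇔ (M p p ≡ M q q))
lemma6p2 n _ G binding M wl u v r s p q _ _ r<n s<n u≢v r≢s wedge wedge′ =
  mk⇔ (edge-pair⇒wedge-pair wedge wedge′ r<n s<n r≢s) (wedge-pair⇒edge-pair wedge wedge′ u≢v) ,
  mk⇔ wedge-pair⇒wedge-colour (wedge-colour⇒wedge-pair wedge wedge′)
  where open BindingGraph binding (IsWL⇒StableRefinement wl)
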